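{- Let $\mathfrak{M}=(W,N,V)$ be a conditional neighbourhood model. Then for every agent $a\in Ag$, every $w\in W$ and every $X\subseteq W$: (m) for all $Y\subseteq Z\subseteq X\cap[w]_a$, if $Y\in N_a^w(X)$ then $Z\in N_a^w(X)$; (no-emptyset) $\emptyset\notin N_a^w(X)$; (n*) if $X\cap[w]_a\neq\emptyset$ then $X\cap[w]_a\in N_a^w(X)$; ($\emptyset$) if $X\cap[w]_a=\emptyset$ then $N_a^w(X)=\emptyset$.
   Context: Fix a set $P$ of proposition letters and a finite set $Ag$ of agents. A conditional neighbourhood model is $\mathfrak{M}=(W,N,V)$ where $W$ is a non-empty set, $V:P\to\mathcal{P}(W)$, and $N$ assigns to every $a\in Ag$, $w\in W$, $X\subseteq W$ a collection $N_a^w(X)\subseteq\mathcal{P}(W)$ such that, writing $[w]_a=\{v\in W\mid \forall X\subseteq W,\ N_a^w(X)=N_a^v(X)\}$, for all $a,w,X$: (c) every $Y\in N_a^w(X)$ satisfies $Y\subseteq X\cap[w]_a$; (ec) for all $Y\subseteq W$, if $X\cap[w]_a=Y\cap[w]_a$ then $N_a^w(X)=N_a^w(Y)$; (d) for all $Y\in N_a^w(X)$, $(X\cap[w]_a)\setminus Y\notin N_a^w(X)$; (sc) for all $Y,Z\subseteq X\cap[w]_a$, if $(X\cap[w]_a)\setminus Y\notin N_a^w(X)$ and $Y\subsetneq Z$, then $Z\in N_a^w(X)$. -}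

module Defs where

open import Level using (0ℓ)
open import Data.Bool using (Bool; true; false; _∧_; not)
open import Data.Nat using (ℕ)
open import Data.Fin using (Fin)
open import Data.Product using (_×_)
open import Relation.Nullary using (¬_; Dec)
open import Relation.Nullary.Decidable using (isYes)
open import Relation.Binary.PropositionalEquality using (_≡_)
open import Function.Bundles using (_⇔_)
open import Axiom.ExcludedMiddle using (ExcludedMiddle)

-- Subsets of a carrier W, represented by characteristic functions.
-- (Classical reading: every subset of W is decidable.)
Subset : Set → Set
Subset W = W → Bool

module _ {W : Set} where

  _∈_ : W → Subset W → Set
  x ∈ X = X x ≡ true

  _⊆_ : Subset W → Subset W → Set
  X ⊆ Y = ∀ x → x ∈ X → x ∈ Y

  _≐_ : Subset W → Subset W → Set
  X ≐ Y = ∀ x → X x ≡ Y x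

  _⊊_ : Subset W → Subset W → Set
  X ⊊ Y = X ⊆ Y × ¬ (X ≐ Y)

  ∅ : Subset W
  ∅ _ = false

  _∩_ : Subset W → Subset W → Subset W
  (X ∩ Y) x = X x ∧ Y x

  _∖_ : Subset W → Subset W → Subset W
  (X ∖ Y) x = X x ∧ not (Y x)

-- Raw conditional neighbourhood frame data over proposition letters P and
-- agents Ag = Fin k.  N a w X Y  means  "Y ∈ N_a^w(X)".
record CNData (P : Set) (k : ℕ) : Set₁ where
  field
    W     : Set
    w₀    : W
    V     : P → Subset W
    N     : Fin k → W → Subset W → Subset W → Set
    -- N_a^w is a function of sets (respects extensional equality)
    N-ext : ∀ a w X X' Y Y' → X ≐ X' → Y ≐ Y' → N a w X Y → N a w X' Y'

  SameCell : Fin k → W → W → Set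
  SameCell a w v = ∀ (X Y : Subset W) → (N a w X Y ⇔ N a v X Y)

  cell : ExcludedMiddle 0ℓ → Fin k → W → Subset W
  cell lem a w v = isYes (lem {SameCell a w v})

record IsCNM {P : Set} {k : ℕ} (lem : ExcludedMiddle 0ℓ) (M : CNData P k) : Set where
  open CNData M
  field
    c  : ∀ a w X Y → N a w X Y → Y ⊆ (X ∩ cell lem a w)
    ec : ∀ a w X Y → (X ∩ cell lem a w) ≐ (Y ∩ cell lem a w) →
         ∀ Z → (N a w X Z ⇔ N a w Y Z)
    d  : ∀ a w X Y → N a w X Y → ¬ N a w X ((X ∩ cell lem a w) ∖ Y)
    sc : ∀ a w X Y Z → Y ⊆ (X ∩ cell lem a w) → Z ⊆ (X ∩ cell lem a w) →
         ¬ N a w X ((X ∩ cell lem a w) ∖ Y) → Y ⊊ Z → N a w X Z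

-- Monotonicity comes from (d) and (sc) together: if Y ∈ N_a^w(X) then (d) puts
-- the relative complement of Y outside N_a^w(X), which is exactly the premise
-- under which (sc) admits every strict superset of Y.  Taking Y = ∅ in (sc),
-- whose relative complement is the whole region C = X ∩ [w]_a, shows that C is
-- in N_a^w(X) as soon as C is non-empty; and ∅ ∈ N_a^w(X) would by monotonicity
-- put C in N_a^w(X) while (d) forbids C = C ∖ ∅.  Condition (c) confines every
-- member of N_a^w(X) to C, so an empty C leaves only ∅, which is excluded.
module Submission where

open import Defs
open import Level using (0ℓ)
open import Data.Nat using (ℕ)
open import Data.Fin using (Fin)
open import Data.Product using (_×_; _,_)
open import Data.Bool using (true; false)
open import Data.Bool.Properties using (∧-identityʳ)
open import Relation.Nullary using (¬_; yes; no)
open import Relation.Binary.PropositionalEquality using (refl; sym; trans)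
open import Axiom.ExcludedMiddle using (ExcludedMiddle)

module _ {W : Set} where

  ≐-refl : {A : Subset W} → A ≐ A
  ≐-refl x = refl

  ≐-sym : {A B : Subset W} → A ≐ B → B ≐ A
  ≐-sym A≐B x = sym (A≐B x)

  ⊆-refl : {A : Subset W} → A ⊆ A
  ⊆-refl x x∈A = x∈A

  ∅-⊆ : (A : Subset W) → ∅ ⊆ A
  ∅-⊆ A x ()

  ∖-identityʳ : (A : Subset W) → (A ∖ ∅) ≐ A
  ∖-identityʳ A x = ∧-identityʳ (A x)

  ⊆-∅⇒≐∅ : {A B : Subset W} → A ⊆ B → B ≐ ∅ → A ≐ ∅
  ⊆-∅⇒≐∅ {A} A⊆B B≐∅ x with A x in x∈A
  ... | false = refl
  ... | true with trans (sym (A⊆B x x∈A)) (B≐∅ x)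
  ...   | ()

module _ (lem : ExcludedMiddle 0ℓ) {P : Set} {k : ℕ} {M : CNData P k}
         (isCNM : IsCNM lem M) where

  open CNData M
  open IsCNM isCNM

  module _ (a : Fin k) (w : W) (X : Subset W) where

    region : Subset W
    region = X ∩ cell lem a w

    N-resp-≐ : ∀ {Y Y′} → Y ≐ Y′ → N a w X Y → N a w X Y′
    N-resp-≐ = N-ext a w X X _ _ ≐-refl

    N-mono : ∀ Y Z → Y ⊆ Z → Z ⊆ region → N a w X Y → N a w X Z
    N-mono Y Z Y⊆Z Z⊆region Y∈N with lem {Y ≐ Z}
    ... | yes Y≐Z = N-resp-≐ Y≐Z Y∈N
    ... | no Y≢Z  = sc a w X Y Z (c a w X Y Y∈N) Z⊆region (d a w X Y Y∈N) (Y⊆Z , Y≢Z)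

    ∅∉N : ¬ N a w X ∅
    ∅∉N ∅∈N = d a w X ∅ ∅∈N (N-resp-≐ (≐-sym (∖-identityʳ region)) region∈N)
      where
      region∈N : N a w X region
      region∈N = N-mono ∅ region (∅-⊆ region) ⊆-refl ∅∈N

    region∈N : ¬ (region ≐ ∅) → N a w X region
    region∈N region≢∅ with lem {N a w X region}
    ... | yes region∈N = region∈N
    ... | no region∉N  =
      sc a w X ∅ region (∅-⊆ region) ⊆-refl
         (λ region∖∅∈N → region∉N (N-resp-≐ (∖-identityʳ region) region∖∅∈N))
         (∅-⊆ region , λ ∅≐region → region≢∅ (≐-sym ∅≐region))

    region≐∅⇒∉N : region ≐ ∅ → ∀ Y → ¬ N a w X Y
    region≐∅⇒∉N region≐∅ Y Y∈N = ∅∉N (N-resp-≐ (⊆-∅⇒≐∅ (c a w X Y Y∈N) region≐∅) Y∈N)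

lemma1 : (lem : ExcludedMiddle 0ℓ) {P : Set} {k : ℕ} (M : CNData P k) →
         IsCNM lem M →
         let open CNData M in
         ∀ a w X →
           (∀ Y Z → Y ⊆ Z → Z ⊆ (X ∩ cell lem a w) → N a w X Y → N a w X Z)
           × ¬ N a w X ∅
           × (¬ ((X ∩ cell lem a w) ≐ ∅) → N a w X (X ∩ cell lem a w))
           × ((X ∩ cell lem a w) ≐ ∅ → ∀ Y → ¬ N a w X Y)
lemma1 lem M isCNM a w X =
  N-mono lem isCNM a w X , ∅∉N lem isCNM a w X ,
  region∈N lem isCNM a w X , region≐∅⇒∉N lem isCNM a w X
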